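{- If $(X,Y)$ is a decomposition of a bull-free monogamous trigraph $T$, then the corresponding blocks $T_X$ and $T_Y$ are bull-free monogamous trigraphs.
   Context: A trigraph $T$ consists of a finite vertex set $V(T)$ and a map $\theta:\binom{V(T)}{2}\to\{ -1,0,1\}$. Distinct $u,v$ are strongly adjacent if $\theta(uv)=1$, strongly antiadjacent if $\theta(uv)=-1$, semiadjacent (a switchable pair) if $\theta(uv)=0$; adjacent if $\theta(uv)\in\{0,1\}$, antiadjacent if $\theta(uv)\in\{ -1,0\}$. $T[X]$ is the restriction to $X$. A vertex $b\notin A$ is strongly complete (strongly anticomplete) to $A$ if strongly adjacent (strongly antiadjacent) to all of $A$; a set is so if all its vertices are. $T$ is monogamous if every vertex is in at most one switchable pair. A bull is a trigraph on $\{x_1,x_2,x_3,y,z\}$ with $x_1,x_2,x_3$ pairwise adjacent, $y$ adjacent to $x_1$ and antiadjacent to $x_2,x_3,z$, $z$ adjacent to $x_2$ and antiadjacent to $x_1,x_3$; bull-free means no $T[X]$ is a bull. A homogeneous set is a set $X$ with $1<|X|<|V(T)|$ such that every vertex outside $X$ is strongly complete or strongly anticomplete to $X$. A homogeneous pair is a pair $(A,B)$ of disjoint nonempty sets together with a split $(A,B,C,D,E,F)$, where $C,D,E,F$ are disjoint (possibly empty) with union $V(T)\setminus(A\cup B)$, such that $A$ is strongly complete to $C\cup E$ and strongly anticomplete to $D\cup F$, $B$ is strongly complete to $D\cup E$ and strongly anticomplete to $C\cup F$, $A$ is neither strongly complete nor strongly anticomplete to $B$, $|A\cup B|\ge3$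 and $|C\cup D\cup E\cup F|\ge3$. It is small if $|A\cup B|\le6$ and proper if $C\ne\emptyset\ne D$. A decomposition of $T$ is a partition $(X,Y)$ of $V(T)$ where $X$ is a homogeneous set or $X=A\cup B$ with $(A,B)$ a small or proper homogeneous pair. Block $T_X$: if $X$ is a homogeneous set or a small homogeneous pair, $T_X=T[X]$; otherwise ($(A,B)$ proper) $T_X$ is $T[X]$ plus new vertices $c,d$, $c$ strongly complete to $A$ and strongly anticomplete to $B$, $d$ strongly complete to $B$ and strongly anticomplete to $A$, $cd$ a switchable pair. Block $T_Y$: if $X$ is a homogeneous set, $T_Y=T[Y\cup\{x\}]$ for some $x\in X$; otherwise ($X=A\cup B$ with split $(A,B,C,D,E,F)$) $T_Y$ is $T[Y]$ plus new vertices $a,b$, $a$ strongly complete to $C\cup E$ and strongly anticomplete to $D\cup F$, $b$ strongly complete to $D\cup E$ and strongly anticomplete to $C\cup F$, $ab$ a switchable pair. -}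

module Defs where

open import Data.Nat using (ℕ; _<_; _≤_; _≤?_)
open import Data.Fin using (Fin)
open import Data.Fin.Subset using (Subset; _∈_; _∉_; ∣_∣; ∁; _∪_; ⁅_⁆)
open import Data.Vec using (tabulate)
open import Data.Bool using (Bool; true; false; if_then_else_)
open import Data.Product using (Σ; Σ-syntax; ∃; ∃-syntax; _×_; _,_; proj₁; proj₂)
open import Data.Sum using (_⊎_)
open import Data.Empty using (⊥)
open import Relation.Nullary using (¬_; does)
open import Relation.Binary.PropositionalEquality using (_≡_; _≢_; refl)

-- The three values of θ : 1 (strong), 0 (semi, switchable), -1 (anti).
data Adj : Set where
  strong semi anti : Adj

-- A trigraph on vertex type V: θ on unordered pairs of distinct vertices,
-- represented as a symmetric function (the diagonal values are irrelevant
-- and never used by any definition below).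
record TG (V : Set) : Set where
  field
    θ   : V → V → Adj
    sym : ∀ u v → θ u v ≡ θ v u
open TG public

Trigraph : Set₁
Trigraph = Σ Set TG

module _ {V : Set} (T : TG V) where
  adjacent : V → V → Set
  adjacent u v = θ T u v ≢ anti

  antiadjacent : V → V → Set
  antiadjacent u v = θ T u v ≢ strong

  IsBull : V → V → V → V → V → Set
  IsBull x₁ x₂ x₃ y z =
    adjacent x₁ x₂ × adjacent x₁ x₃ × adjacent x₂ x₃ ×
    adjacent y x₁ × antiadjacent y x₂ × antiadjacent y x₃ × antiadjacent y z ×
    adjacent z x₂ × antiadjacent z x₁ × antiadjacent z x₃

  Distinct5 : V → V → V → V → V → Set
  Distinct5 a b c d e =
    a ≢ b × a ≢ c × a ≢ d × a ≢ e × b ≢ c × b ≢ d × b ≢ e ×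
    c ≢ d × c ≢ e × d ≢ e

  BullFree : Set
  BullFree = ∀ x₁ x₂ x₃ y z → Distinct5 x₁ x₂ x₃ y z → ¬ IsBull x₁ x₂ x₃ y z

  Monogamous : Set
  Monogamous = ∀ u v w → u ≢ v → u ≢ w →
    θ T u v ≡ semi → θ T u w ≡ semi → v ≡ w

BullFreeMonogamous : Trigraph → Set
BullFreeMonogamous (V , T) = BullFree T × Monogamous T

restrict : {V : Set} → TG V → (P : V → Set) → TG (Σ V P)
restrict T P = record
  { θ   = λ u v → θ T (proj₁ u) (proj₁ v)
  ; sym = λ u v → sym T (proj₁ u) (proj₁ v) }

_[_] : {n : ℕ} → TG (Fin n) → Subset n → Trigraph
_[_] {n} T X = (Σ (Fin n) (λ v → v ∈ X)) , restrict T (λ v → v ∈ X)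

data Ext (V : Set) : Set where
  old : V → Ext V
  newp newq : Ext V

extend : {V : Set} → TG V → (f g : V → Adj) → TG (Ext V)
extend {V} T f g = record { θ = t ; sym = s }
  where
  t : Ext V → Ext V → Adj
  t (old u) (old v) = θ T u v
  t (old u) newp    = f u
  t (old u) newq    = g u
  t newp    (old v) = f v
  t newq    (old v) = g v
  t newp    newq    = semi
  t newq    newp    = semi
  t newp    newp    = anti
  t newq    newq    = anti
  s : ∀ u v → t u v ≡ t v u
  s (old u) (old v) = sym T u v
  s (old u) newp    = refl
  s (old u) newq    = refl
  s newp    (old v) = refl
  s newq    (old v) = refl
  s newp    newq    = refl
  s newq    newp    = refl
  s newp    newp    = refl
  s newq    newq    = refl

module _ {n : ℕ} (T : TG (Fin n)) where

  HomogeneousSet : Subset n → Set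
  HomogeneousSet X =
    1 < ∣ X ∣ × ∣ X ∣ < n ×
    (∀ v → v ∉ X →
       (∀ x → x ∈ X → θ T v x ≡ strong) ⊎ (∀ x → x ∈ X → θ T v x ≡ anti))

  TX-hom : Subset n → Trigraph
  TX-hom X = T [ X ]

  TY-hom : Subset n → Fin n → Trigraph
  TY-hom X x = T [ ∁ X ∪ ⁅ x ⁆ ]

-- Homogeneous pairs.  A homogeneous pair (A,B) with split (A,B,C,D,E,F)
-- is encoded by a labelling of V(T) by the six parts (this makes the six
-- sets disjoint with union V(T)).

data Part : Set where
  pA pB pC pD pE pF : Part

isAB : Part → Bool
isAB pA = true
isAB pB = true
isAB _  = false

isCDEF : Part → Bool
isCDEF pA = false
isCDEF pB = false
isCDEF _  = true

module _ {n : ℕ} (T : TG (Fin n)) (L : Fin n → Part) where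

  AB : Subset n
  AB = tabulate (λ v → isAB (L v))

  CDEF : Subset n
  CDEF = tabulate (λ v → isCDEF (L v))

  HomogeneousPair : Set
  HomogeneousPair =
    (∃[ a ] L a ≡ pA) × (∃[ b ] L b ≡ pB) ×
    (∀ a v → L a ≡ pA → (L v ≡ pC ⊎ L v ≡ pE) → θ T a v ≡ strong) ×
    (∀ a v → L a ≡ pA → (L v ≡ pD ⊎ L v ≡ pF) → θ T a v ≡ anti) ×
    (∀ b v → L b ≡ pB → (L v ≡ pD ⊎ L v ≡ pE) → θ T b v ≡ strong) ×
    (∀ b v → L b ≡ pB → (L v ≡ pC ⊎ L v ≡ pF) → θ T b v ≡ anti) ×
    ¬ (∀ a b → L a ≡ pA → L b ≡ pB → θ T a b ≡ strong) ×
    ¬ (∀ a b → L a ≡ pA → L b ≡ pB → θ T a b ≡ anti) ×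
    3 ≤ ∣ AB ∣ × 3 ≤ ∣ CDEF ∣

  Small : Set
  Small = ∣ AB ∣ ≤ 6

  Proper : Set
  Proper = (∃[ c ] L c ≡ pC) × (∃[ d ] L d ≡ pD)

  -- values of the new vertices c, d of T_X on an old vertex with a given part
  cval dval : Part → Adj
  cval pA = strong
  cval _  = anti
  dval pB = strong
  dval _  = anti

  -- values of the new vertices a, b of T_Y
  aval bval : Part → Adj
  aval pC = strong
  aval pE = strong
  aval _  = anti
  bval pD = strong
  bval pE = strong
  bval _  = anti

  private
    VX : Set
    VX = Σ (Fin n) (λ v → v ∈ AB)
    VY : Set
    VY = Σ (Fin n) (λ v → v ∈ CDEF)

  -- T_X: T[A ∪ B] if small, otherwise (proper case) T[A ∪ B] plus c, d
  TX-pair : Trigraph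
  TX-pair =
    if does (∣ AB ∣ ≤? 6)
    then T [ AB ]
    else (Ext VX , extend (restrict T (λ v → v ∈ AB))
                          (λ u → cval (L (proj₁ u))) (λ u → dval (L (proj₁ u))))

  TY-pair : Trigraph
  TY-pair = Ext VY , extend (restrict T (λ v → v ∈ CDEF))
                            (λ u → aval (L (proj₁ u))) (λ u → bval (L (proj₁ u)))

-- Every block is either an induced subtrigraph T[X] or such a T[X] extended by two new vertices
-- p, q that form a switchable pair and see every old vertex exactly as some vertices p', q' of T
-- outside X do.  Induced subtrigraphs inherit both properties directly.  In an extension the new
-- vertices meet no other switchable pair, so monogamy survives.  For bull-freeness we send
-- p ↦ p', q ↦ q': this map is injective and preserves θ on every pair except {p, q}, so a bull of
-- the extension lifts to a bull of T as soon as the requirement (edge or non-edge) that the bull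
-- places on {p, q}, if it contains both, is met by θ(p', q').
--   * In T_X of a proper homogeneous pair, c and d have neither a common neighbour nor a common
--     antineighbour, whereas any two vertices of a bull have one of them: no bull uses both.
--   * In T_Y the new pair {a, b} is an edge or a non-edge of the bull, never both; as A is neither
--     strongly complete nor strongly anticomplete to B, some a' ∈ A, b' ∈ B meet the requirement.
module Submission where

open import Defs
open import Data.Nat using (ℕ; _≤?_)
open import Data.Fin using (Fin)
open import Data.Fin.Subset using (Subset; _∈_; _∉_; ∁; _∪_; ⁅_⁆; ∣_∣)
open import Data.Bool using (Bool; true; false; if_then_else_)
open import Data.Vec using (tabulate)
open import Data.Vec.Properties using ([]=⇒lookup; lookup∘tabulate)
open import Data.Vec.Properties.WithK using ([]=-irrelevant)
open import Data.Product using (Σ; _×_; _,_; proj₁; proj₂)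
open import Data.Sum using (_⊎_; inj₁; inj₂)
open import Data.Empty using (⊥; ⊥-elim)
open import Relation.Nullary using (¬_; Dec; yes; no; does)
open import Relation.Nullary.Decidable using (_×-dec_)
open import Relation.Binary.PropositionalEquality
  using (_≡_; _≢_; refl; cong; trans; subst; ≢-sym) renaming (sym to ≡-sym)

not-adjacent : ∀ {s} → ¬ (s ≢ anti) → s ≡ anti
not-adjacent {strong} h = ⊥-elim (h (λ ()))
not-adjacent {semi}   h = ⊥-elim (h (λ ()))
not-adjacent {anti}   h = refl

not-antiadjacent : ∀ {s} → ¬ (s ≢ strong) → s ≡ strong
not-antiadjacent {strong} h = refl
not-antiadjacent {semi}   h = ⊥-elim (h (λ ()))
not-antiadjacent {anti}   h = ⊥-elim (h (λ ()))

adjacent-sym : ∀ {V} (S : TG V) {u v} → adjacent S u v → adjacent S v u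
adjacent-sym S {u} {v} a e = a (trans (sym S u v) e)

antiadjacent-sym : ∀ {V} (S : TG V) {u v} → antiadjacent S u v → antiadjacent S v u
antiadjacent-sym S {u} {v} a e = a (trans (sym S u v) e)

if-dec : ∀ {A : Set} {B : Set₁} (Prop : B → Set) (d : Dec A) {x y : B} →
  (A → Prop x) → (¬ A → Prop y) → Prop (if does d then x else y)
if-dec Prop (yes a) on-yes _ = on-yes a
if-dec Prop (no ¬a) _ on-no = on-no ¬a

distinct-image : ∀ {V W} (S : TG V) (T : TG W) (φ : V → W) → (∀ {u v} → u ≢ v → φ u ≢ φ v) →
  ∀ {x₁ x₂ x₃ y z} → Distinct5 S x₁ x₂ x₃ y z → Distinct5 T (φ x₁) (φ x₂) (φ x₃) (φ y) (φ z)
distinct-image S T φ inj (d₁ , d₂ , d₃ , d₄ , d₅ , d₆ , d₇ , d₈ , d₉ , d₁₀) =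
  inj d₁ , inj d₂ , inj d₃ , inj d₄ , inj d₅ , inj d₆ , inj d₇ , inj d₈ , inj d₉ , inj d₁₀

Edges NonEdges : ∀ {V : Set} → (V → V → Set) → V → V → V → V → V → Set
Edges    R x₁ x₂ x₃ y z = R x₁ x₂ × R x₁ x₃ × R x₂ x₃ × R y x₁ × R z x₂
NonEdges R x₁ x₂ x₃ y z = R y x₂ × R y x₃ × R y z × R z x₁ × R z x₃

Separated : ∀ {V} → TG V → V → V → Set
Separated S u v =
  (∀ w → adjacent S u w → adjacent S v w → ⊥) ×
  (∀ w → w ≢ u → w ≢ v → antiadjacent S u w → antiadjacent S v w → ⊥)

-- Any two vertices of a bull have a common neighbour or a common antineighbour in the bull.
-- Hence if E-related distinct vertices are always separated, no pair of a bull is E-related.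
bull-avoids : ∀ {V} (S : TG V) (E : V → V → Set) → (∀ {u v} → u ≢ v → E u v → Separated S u v) →
  ∀ {x₁ x₂ x₃ y z} → Distinct5 S x₁ x₂ x₃ y z → IsBull S x₁ x₂ x₃ y z →
  Edges (λ u v → ¬ E u v) x₁ x₂ x₃ y z × NonEdges (λ u v → ¬ E u v) x₁ x₂ x₃ y z
bull-avoids S E sep {x₁} {x₂} {x₃} {y} {z}
  (d12 , d13 , d1y , d1z , d23 , d2y , d2z , d3y , d3z , dyz)
  (a12 , a13 , a23 , ay1 , ny2 , ny3 , nyz , az2 , nz1 , nz3) =
  ( (λ e → proj₁ (sep d12 e) x₃ a13 a23)
  , (λ e → proj₁ (sep d13 e) x₂ a12 (adj a23))
  , (λ e → proj₁ (sep d23 e) x₁ (adj a12) (adj a13))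
  , (λ e → proj₂ (sep (≢-sym d1y) e) z (≢-sym dyz) (≢-sym d1z) nyz (anti-sym nz1))
  , (λ e → proj₂ (sep (≢-sym d2z) e) y dyz (≢-sym d2y) (anti-sym nyz) (anti-sym ny2)) )
  ,
  ( (λ e → proj₁ (sep (≢-sym d2y) e) x₁ ay1 (adj a12))
  , (λ e → proj₁ (sep (≢-sym d3y) e) x₁ ay1 (adj a13))
  , (λ e → proj₂ (sep dyz e) x₃ d3y d3z ny3 nz3)
  , (λ e → proj₁ (sep (≢-sym d1z) e) x₂ az2 a12)
  , (λ e → proj₁ (sep (≢-sym d3z) e) x₂ az2 (adj a23)) )
  where
  adj : ∀ {u v} → adjacent S u v → adjacent S v u
  adj = adjacent-sym S
  anti-sym : ∀ {u v} → antiadjacent S u v → antiadjacent S v u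
  anti-sym = antiadjacent-sym S

-- Restrictions: T[P] embeds into T via proj₁, so it inherits bull-freeness and monogamy.

module Restriction {V : Set} (T : TG V) (P : V → Set)
                   (P-irrelevant : ∀ {v} (x y : P v) → x ≡ y) where

  proj₁-injective : ∀ {u v : Σ V P} → proj₁ u ≡ proj₁ v → u ≡ v
  proj₁-injective {u , x} {.u , y} refl = cong (u ,_) (P-irrelevant x y)

  proj₁-≢ : ∀ {u v : Σ V P} → u ≢ v → proj₁ u ≢ proj₁ v
  proj₁-≢ ne e = ne (proj₁-injective e)

  restrict-bullFree : BullFree T → BullFree (restrict T P)
  restrict-bullFree bf x₁ x₂ x₃ y z d bull =
    bf _ _ _ _ _ (distinct-image (restrict T P) T proj₁ proj₁-≢ d) bull

  restrict-monogamous : Monogamous T → Monogamous (restrict T P)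
  restrict-monogamous mono u v w uv uw e₁ e₂ =
    proj₁-injective (mono _ _ _ (proj₁-≢ uv) (proj₁-≢ uw) e₁ e₂)

-- Membership in a subset of Fin n is proof-irrelevant, so T[X] is a restriction as above.
∈-irrelevant : ∀ {n} {X : Subset n} {v} (x y : v ∈ X) → x ≡ y
∈-irrelevant = []=-irrelevant

restriction-bullFree-monogamous : ∀ {n} (T : TG (Fin n)) → BullFree T → Monogamous T →
  (X : Subset n) → BullFreeMonogamous (T [ X ])
restriction-bullFree-monogamous T bf mono X =
  restrict-bullFree bf , restrict-monogamous mono
  where open Restriction T (_∈ X) ∈-irrelevant

data New {V : Set} : Ext V → Set where
  newp-new : New newp
  newq-new : New newq

new? : ∀ {V} (u : Ext V) → Dec (New u)
new? (old _) = no (λ ())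
new? newp    = yes newp-new
new? newq    = yes newq-new

NewPair : ∀ {V} → Ext V → Ext V → Set
NewPair u v = New u × New v

module _ {V : Set} {Q : Set} {x₁ x₂ x₃ y z : Ext V} where

  edges-vacuous : Edges (λ u v → ¬ NewPair u v) x₁ x₂ x₃ y z →
    Edges (λ u v → NewPair u v → Q) x₁ x₂ x₃ y z
  edges-vacuous (r₁ , r₂ , r₃ , r₄ , r₅) =
    (λ e → ⊥-elim (r₁ e)) , (λ e → ⊥-elim (r₂ e)) , (λ e → ⊥-elim (r₃ e)) ,
    (λ e → ⊥-elim (r₄ e)) , (λ e → ⊥-elim (r₅ e))

  nonedges-vacuous : NonEdges (λ u v → ¬ NewPair u v) x₁ x₂ x₃ y z →
    NonEdges (λ u v → NewPair u v → Q) x₁ x₂ x₃ y z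
  nonedges-vacuous (r₁ , r₂ , r₃ , r₄ , r₅) =
    (λ e → ⊥-elim (r₁ e)) , (λ e → ⊥-elim (r₂ e)) , (λ e → ⊥-elim (r₃ e)) ,
    (λ e → ⊥-elim (r₄ e)) , (λ e → ⊥-elim (r₅ e))

  edges-met : Q → Edges (λ u v → NewPair u v → Q) x₁ x₂ x₃ y z
  edges-met q = (λ _ → q) , (λ _ → q) , (λ _ → q) , (λ _ → q) , (λ _ → q)

  nonedges-met : Q → NonEdges (λ u v → NewPair u v → Q) x₁ x₂ x₃ y z
  nonedges-met q = (λ _ → q) , (λ _ → q) , (λ _ → q) , (λ _ → q) , (λ _ → q)

at-most-two-new : ∀ {V} {u v w : Ext V} → u ≢ v → u ≢ w → v ≢ w → New u → New v → ¬ New w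
at-most-two-new uv uw vw newp-new newp-new _        = uv refl
at-most-two-new uv uw vw newq-new newq-new _        = uv refl
at-most-two-new uv uw vw newp-new newq-new newp-new = uw refl
at-most-two-new uv uw vw newp-new newq-new newq-new = vw refl
at-most-two-new uv uw vw newq-new newp-new newp-new = vw refl
at-most-two-new uv uw vw newq-new newp-new newq-new = uw refl

module Extension {W : Set} (T : TG W) (f g : W → Adj) where

  S : TG (Ext W)
  S = extend T f g

  extend-monogamous : Monogamous T → (∀ w → f w ≢ semi × g w ≢ semi) → Monogamous S
  extend-monogamous mono definite = go
    where
    partner-of-newp : ∀ w → θ S newp w ≡ semi → w ≡ newq
    partner-of-newp (old w) e = ⊥-elim (proj₁ (definite w) e)
    partner-of-newp newq    _ = refl

    partner-of-newq : ∀ w → θ S newq w ≡ semi → w ≡ newp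
    partner-of-newq (old w) e = ⊥-elim (proj₂ (definite w) e)
    partner-of-newq newp    _ = refl

    go : Monogamous S
    go (old u) (old v) (old w) uv uw e₁ e₂ =
      cong old (mono u v w (λ e → uv (cong old e)) (λ e → uw (cong old e)) e₁ e₂)
    go (old u) newp    _       _  _  e₁ _  = ⊥-elim (proj₁ (definite u) e₁)
    go (old u) newq    _       _  _  e₁ _  = ⊥-elim (proj₂ (definite u) e₁)
    go (old u) (old v) newp    _  _  _  e₂ = ⊥-elim (proj₁ (definite u) e₂)
    go (old u) (old v) newq    _  _  _  e₂ = ⊥-elim (proj₂ (definite u) e₂)
    go newp    v       w       _  _  e₁ e₂ =
      trans (partner-of-newp v e₁) (≡-sym (partner-of-newp w e₂))
    go newq    v       w       _  _  e₁ e₂ =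
      trans (partner-of-newq v e₁) (≡-sym (partner-of-newq w e₂))

  new-pair-separated : (∀ w → f w ≢ anti → g w ≢ anti → ⊥) →
    (∀ w → f w ≢ strong → g w ≢ strong → ⊥) →
    ∀ {u v} → u ≢ v → NewPair u v → Separated S u v
  new-pair-separated both-adj both-anti ne (newp-new , newp-new) = ⊥-elim (ne refl)
  new-pair-separated both-adj both-anti ne (newq-new , newq-new) = ⊥-elim (ne refl)
  new-pair-separated both-adj both-anti ne (newp-new , newq-new) = p-q-separated
    where
    p-q-separated : Separated S newp newq
    p-q-separated = common-neighbour , common-antineighbour
      where
      common-neighbour : ∀ w → adjacent S newp w → adjacent S newq w → ⊥
      common-neighbour (old w) a b = both-adj w a b
      common-neighbour newp    a _ = a refl
      common-neighbour newq    _ b = b refl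
      common-antineighbour : ∀ w → w ≢ newp → w ≢ newq →
        antiadjacent S newp w → antiadjacent S newq w → ⊥
      common-antineighbour (old w) _  _  a b = both-anti w a b
      common-antineighbour newp    wp _  _ _ = wp refl
      common-antineighbour newq    _  wq _ _ = wq refl
  new-pair-separated both-adj both-anti ne (newq-new , newp-new) =
    let (nbr , antinbr) = new-pair-separated both-adj both-anti (≢-sym ne) (newp-new , newq-new)
    in (λ w a b → nbr w b a) , (λ w wq wp a b → antinbr w wp wq b a)

old-left : ∀ {V} {u v : Ext V} → ¬ New u → ¬ NewPair u v
old-left o (nu , _) = o nu

old-right : ∀ {V} {u v : Ext V} → ¬ New v → ¬ NewPair u v
old-right o (_ , nv) = o nv

new-pair-position : ∀ {V} (S : TG (Ext V)) {x₁ x₂ x₃ y z} → Distinct5 S x₁ x₂ x₃ y z →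
  NonEdges (λ u v → ¬ NewPair u v) x₁ x₂ x₃ y z ⊎ Edges (λ u v → ¬ NewPair u v) x₁ x₂ x₃ y z
new-pair-position S {x₁} {x₂} {x₃} {y} {z}
  (d12 , d13 , d1y , d1z , d23 , d2y , d2z , d3y , d3z , dyz)
  with new? y | new? z | new? x₁ | new? x₂
... | yes ny | _ | yes n1 | _ =
  inj₁ (old-right o2 , old-right o3 , old-right oz , old-left oz , old-left oz)
  where
  o2 : ¬ New x₂
  o2 = at-most-two-new (≢-sym d1y) (≢-sym d2y) d12 ny n1
  o3 : ¬ New x₃
  o3 = at-most-two-new (≢-sym d1y) (≢-sym d3y) d13 ny n1
  oz : ¬ New z
  oz = at-most-two-new (≢-sym d1y) dyz d1z ny n1
... | yes ny | _ | no o1 | _ =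
  inj₂ ( old-left o1 , old-left o1 , (λ (n2 , n3) → at-most-two-new d23 d2y d3y n2 n3 ny)
       , old-right o1 , (λ (nz , n2) → at-most-two-new (≢-sym d2z) (≢-sym dyz) d2y nz n2 ny) )
... | no oy | yes nz | _ | yes n2 =
  inj₁ ( old-left oy , old-left oy , old-left oy
       , old-right (at-most-two-new (≢-sym d2z) (≢-sym d1z) (≢-sym d12) nz n2)
       , old-right (at-most-two-new (≢-sym d2z) (≢-sym d3z) d23 nz n2) )
... | no oy | yes nz | _ | no o2 =
  inj₂ ( old-right o2 , (λ (n1 , n3) → at-most-two-new d13 d1z d3z n1 n3 nz) , old-left o2
       , old-left oy , old-right o2 )
... | no oy | no oz | _ | _ =
  inj₁ (old-left oy , old-left oy , old-left oy , old-left oz , old-left oz)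

module Lift {V : Set} (T : TG V) (P : V → Set) (P-irrelevant : ∀ {v} (x y : P v) → x ≡ y)
            (f g : Σ V P → Adj) (p q : V) (p∉P : ¬ P p) (q∉P : ¬ P q) (p≢q : p ≢ q)
            (sees-p : ∀ u → θ T (proj₁ u) p ≡ f u) (sees-q : ∀ u → θ T (proj₁ u) q ≡ g u) where

  open Restriction T P P-irrelevant using (proj₁-injective)
  open Extension (restrict T P) f g using (S)

  φ : Ext (Σ V P) → V
  φ (old u) = proj₁ u
  φ newp    = p
  φ newq    = q

  φ-injective : ∀ {u v} → u ≢ v → φ u ≢ φ v
  φ-injective {old u} {old v} ne e = ne (cong old (proj₁-injective e))
  φ-injective {old u} {newp}  _  e = p∉P (subst P e (proj₂ u))
  φ-injective {old u} {newq}  _  e = q∉P (subst P e (proj₂ u))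
  φ-injective {newp}  {old v} _  e = p∉P (subst P (≡-sym e) (proj₂ v))
  φ-injective {newq}  {old v} _  e = q∉P (subst P (≡-sym e) (proj₂ v))
  φ-injective {newp}  {newp}  ne _ = ne refl
  φ-injective {newq}  {newq}  ne _ = ne refl
  φ-injective {newp}  {newq}  _  e = p≢q e
  φ-injective {newq}  {newp}  _  e = p≢q (≡-sym e)

  agree : ∀ u v → ¬ NewPair u v → θ S u v ≡ θ T (φ u) (φ v)
  agree (old u) (old v) _  = refl
  agree (old u) newp    _  = ≡-sym (sees-p u)
  agree (old u) newq    _  = ≡-sym (sees-q u)
  agree newp    (old v) _  = trans (≡-sym (sees-p v)) (sym T (proj₁ v) p)
  agree newq    (old v) _  = trans (≡-sym (sees-q v)) (sym T (proj₁ v) q)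
  agree newp    newp    nn = ⊥-elim (nn (newp-new , newp-new))
  agree newp    newq    nn = ⊥-elim (nn (newp-new , newq-new))
  agree newq    newp    nn = ⊥-elim (nn (newq-new , newp-new))
  agree newq    newq    nn = ⊥-elim (nn (newq-new , newq-new))

  new-pair-image : ∀ {u v} → u ≢ v → NewPair u v → θ T (φ u) (φ v) ≡ θ T p q
  new-pair-image ne (newp-new , newp-new) = ⊥-elim (ne refl)
  new-pair-image _  (newp-new , newq-new) = refl
  new-pair-image _  (newq-new , newp-new) = sym T q p
  new-pair-image ne (newq-new , newq-new) = ⊥-elim (ne refl)

  carry : (R : Adj → Set) → ∀ {u v} → u ≢ v → (NewPair u v → R (θ T p q)) →
    R (θ S u v) → R (θ T (φ u) (φ v))
  carry R {u} {v} ne at-pq r with new? u ×-dec new? v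
  ... | yes uv = subst R (≡-sym (new-pair-image ne uv)) (at-pq uv)
  ... | no ¬uv = subst R (agree u v ¬uv) r

  lift-refutes : BullFree T → ∀ {x₁ x₂ x₃ y z} →
    Distinct5 S x₁ x₂ x₃ y z → IsBull S x₁ x₂ x₃ y z →
    Edges (λ u v → NewPair u v → adjacent T p q) x₁ x₂ x₃ y z →
    NonEdges (λ u v → NewPair u v → antiadjacent T p q) x₁ x₂ x₃ y z → ⊥
  lift-refutes bf {x₁} {x₂} {x₃} {y} {z}
    d@(d12 , d13 , d1y , d1z , d23 , d2y , d2z , d3y , d3z , dyz)
    (a12 , a13 , a23 , ay1 , ny2 , ny3 , nyz , az2 , nz1 , nz3)
    (h12 , h13 , h23 , hy1 , hz2) (hy2 , hy3 , hyz , hz1 , hz3) =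
    bf (φ x₁) (φ x₂) (φ x₃) (φ y) (φ z) (distinct-image S T φ φ-injective d)
      ( carry (_≢ anti) d12 h12 a12 , carry (_≢ anti) d13 h13 a13
      , carry (_≢ anti) d23 h23 a23 , carry (_≢ anti) (≢-sym d1y) hy1 ay1
      , carry (_≢ strong) (≢-sym d2y) hy2 ny2 , carry (_≢ strong) (≢-sym d3y) hy3 ny3
      , carry (_≢ strong) dyz hyz nyz , carry (_≢ anti) (≢-sym d2z) hz2 az2
      , carry (_≢ strong) (≢-sym d1z) hz1 nz1 , carry (_≢ strong) (≢-sym d3z) hz3 nz3 )

∈-tabulate : ∀ {n} (h : Fin n → Bool) {v} → v ∈ tabulate h → h v ≡ true
∈-tabulate h {v} v∈ = trans (≡-sym (lookup∘tabulate h v)) ([]=⇒lookup v∈)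

∉-tabulate : ∀ {n} (h : Fin n → Bool) {v} → h v ≡ false → v ∉ tabulate h
∉-tabulate h hv v∈ with trans (≡-sym hv) (∈-tabulate h v∈)
... | ()

module HomogeneousPairBlocks {n : ℕ} (T : TG (Fin n)) (L : Fin n → Part) where

  label-≢ : ∀ {u v l l′} → L u ≡ l → L v ≡ l′ → l ≢ l′ → u ≢ v
  label-≢ Lu Lv ne refl = ne (trans (≡-sym Lu) Lv)

  c-d-definite : ∀ l → cval T L l ≢ semi × dval T L l ≢ semi
  c-d-definite pA = (λ ()) , (λ ())
  c-d-definite pB = (λ ()) , (λ ())
  c-d-definite pC = (λ ()) , (λ ())
  c-d-definite pD = (λ ()) , (λ ())
  c-d-definite pE = (λ ()) , (λ ())
  c-d-definite pF = (λ ()) , (λ ())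

  a-b-definite : ∀ l → aval T L l ≢ semi × bval T L l ≢ semi
  a-b-definite pA = (λ ()) , (λ ())
  a-b-definite pB = (λ ()) , (λ ())
  a-b-definite pC = (λ ()) , (λ ())
  a-b-definite pD = (λ ()) , (λ ())
  a-b-definite pE = (λ ()) , (λ ())
  a-b-definite pF = (λ ()) , (λ ())

  c-d-not-both-adjacent : ∀ l → cval T L l ≢ anti → dval T L l ≢ anti → ⊥
  c-d-not-both-adjacent pA _ d = d refl
  c-d-not-both-adjacent pB c _ = c refl
  c-d-not-both-adjacent pC c _ = c refl
  c-d-not-both-adjacent pD c _ = c refl
  c-d-not-both-adjacent pE c _ = c refl
  c-d-not-both-adjacent pF c _ = c refl

  c-d-not-both-antiadjacent : ∀ l → isAB l ≡ true → cval T L l ≢ strong → dval T L l ≢ strong → ⊥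
  c-d-not-both-antiadjacent pA _ c _ = c refl
  c-d-not-both-antiadjacent pB _ _ d = d refl

  c-value d-value : Σ (Fin n) (_∈ AB T L) → Adj
  c-value u = cval T L (L (proj₁ u))
  d-value u = dval T L (L (proj₁ u))

  a-value b-value : Σ (Fin n) (_∈ CDEF T L) → Adj
  a-value u = aval T L (L (proj₁ u))
  b-value u = bval T L (L (proj₁ u))

  module TX = Extension (restrict T (_∈ AB T L)) c-value d-value
  module TY = Extension (restrict T (_∈ CDEF T L)) a-value b-value

  module _ (hp : HomogeneousPair T L) where

    private
      A-complete : ∀ a v → L a ≡ pA → (L v ≡ pC ⊎ L v ≡ pE) → θ T a v ≡ strong
      A-complete = let (_ , _ , h , _) = hp in h
      A-anticomplete : ∀ a v → L a ≡ pA → (L v ≡ pD ⊎ L v ≡ pF) → θ T a v ≡ anti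
      A-anticomplete = let (_ , _ , _ , h , _) = hp in h
      B-complete : ∀ b v → L b ≡ pB → (L v ≡ pD ⊎ L v ≡ pE) → θ T b v ≡ strong
      B-complete = let (_ , _ , _ , _ , h , _) = hp in h
      B-anticomplete : ∀ b v → L b ≡ pB → (L v ≡ pC ⊎ L v ≡ pF) → θ T b v ≡ anti
      B-anticomplete = let (_ , _ , _ , _ , _ , h , _) = hp in h
      not-complete : ¬ (∀ a b → L a ≡ pA → L b ≡ pB → θ T a b ≡ strong)
      not-complete = let (_ , _ , _ , _ , _ , _ , h , _) = hp in h
      not-anticomplete : ¬ (∀ a b → L a ≡ pA → L b ≡ pB → θ T a b ≡ anti)
      not-anticomplete = let (_ , _ , _ , _ , _ , _ , _ , h , _) = hp in h

    sees-as-c : ∀ {c} → L c ≡ pC → ∀ u → u ∈ AB T L → θ T u c ≡ cval T L (L u)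
    sees-as-c {c} Lc u u∈ with L u in Lu | ∈-tabulate (λ v → isAB (L v)) u∈
    ... | pA | _ = A-complete u c Lu (inj₁ Lc)
    ... | pB | _ = B-anticomplete u c Lu (inj₁ Lc)

    sees-as-d : ∀ {d} → L d ≡ pD → ∀ u → u ∈ AB T L → θ T u d ≡ dval T L (L u)
    sees-as-d {d} Ld u u∈ with L u in Lu | ∈-tabulate (λ v → isAB (L v)) u∈
    ... | pA | _ = A-anticomplete u d Lu (inj₁ Ld)
    ... | pB | _ = B-complete u d Lu (inj₁ Ld)

    sees-as-a : ∀ {a} → L a ≡ pA → ∀ u → u ∈ CDEF T L → θ T u a ≡ aval T L (L u)
    sees-as-a {a} La u u∈ with L u in Lu | ∈-tabulate (λ v → isCDEF (L v)) u∈
    ... | pC | _ = trans (sym T u a) (A-complete a u La (inj₁ Lu))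
    ... | pD | _ = trans (sym T u a) (A-anticomplete a u La (inj₁ Lu))
    ... | pE | _ = trans (sym T u a) (A-complete a u La (inj₂ Lu))
    ... | pF | _ = trans (sym T u a) (A-anticomplete a u La (inj₂ Lu))

    sees-as-b : ∀ {b} → L b ≡ pB → ∀ u → u ∈ CDEF T L → θ T u b ≡ bval T L (L u)
    sees-as-b {b} Lb u u∈ with L u in Lu | ∈-tabulate (λ v → isCDEF (L v)) u∈
    ... | pC | _ = trans (sym T u b) (B-anticomplete b u Lb (inj₁ Lu))
    ... | pD | _ = trans (sym T u b) (B-complete b u Lb (inj₁ Lu))
    ... | pE | _ = trans (sym T u b) (B-complete b u Lb (inj₂ Lu))
    ... | pF | _ = trans (sym T u b) (B-anticomplete b u Lb (inj₂ Lu))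

    -- T_X of a proper homogeneous pair: lift along c ↦ c′ ∈ C, d ↦ d′ ∈ D; no bull contains
    -- both c and d since they are separated.
    proper-TX-bullFree : BullFree T → Proper T L → BullFree TX.S
    proper-TX-bullFree bf ((c′ , Lc′) , (d′ , Ld′)) x₁ x₂ x₃ y z dist bull =
      lift-refutes bf dist bull (edges-vacuous (proj₁ avoided)) (nonedges-vacuous (proj₂ avoided))
      where
      open Lift T (_∈ AB T L) ∈-irrelevant c-value d-value c′ d′
        (∉-tabulate _ (cong isAB Lc′)) (∉-tabulate _ (cong isAB Ld′)) (label-≢ Lc′ Ld′ (λ ()))
        (λ u → sees-as-c Lc′ (proj₁ u) (proj₂ u)) (λ u → sees-as-d Ld′ (proj₁ u) (proj₂ u))
      separated : ∀ {u v} → u ≢ v → NewPair u v → Separated TX.S u v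
      separated = TX.new-pair-separated (λ w → c-d-not-both-adjacent (L (proj₁ w)))
        (λ w → c-d-not-both-antiadjacent (L (proj₁ w)) (∈-tabulate _ (proj₂ w)))
      avoided : Edges (λ u v → ¬ NewPair u v) x₁ x₂ x₃ y z ×
                NonEdges (λ u v → ¬ NewPair u v) x₁ x₂ x₃ y z
      avoided = bull-avoids TX.S NewPair separated dist bull

    TY-refute : BullFree T → ∀ {a′ b′} → L a′ ≡ pA → L b′ ≡ pB → ∀ {x₁ x₂ x₃ y z} →
      Distinct5 TY.S x₁ x₂ x₃ y z → IsBull TY.S x₁ x₂ x₃ y z →
      Edges (λ u v → NewPair u v → adjacent T a′ b′) x₁ x₂ x₃ y z →
      NonEdges (λ u v → NewPair u v → antiadjacent T a′ b′) x₁ x₂ x₃ y z → ⊥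
    TY-refute bf {a′} {b′} La′ Lb′ = lift-refutes bf
      where
      open Lift T (_∈ CDEF T L) ∈-irrelevant a-value b-value a′ b′
        (∉-tabulate _ (cong isCDEF La′)) (∉-tabulate _ (cong isCDEF Lb′)) (label-≢ La′ Lb′ (λ ()))
        (λ u → sees-as-a La′ (proj₁ u) (proj₂ u)) (λ u → sees-as-b Lb′ (proj₁ u) (proj₂ u))

    -- If {a, b} is not a non-edge of the bull, an adjacent pair a′ b′ refutes it, and such a
    -- pair exists since A is not strongly anticomplete to B; symmetrically otherwise.
    TY-bullFree : BullFree T → BullFree TY.S
    TY-bullFree bf x₁ x₂ x₃ y z dist bull with new-pair-position TY.S dist
    ... | inj₁ no-new-nonedge = not-anticomplete λ a′ b′ La′ Lb′ → not-adjacent λ adj →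
      TY-refute bf La′ Lb′ dist bull (edges-met adj) (nonedges-vacuous no-new-nonedge)
    ... | inj₂ no-new-edge = not-complete λ a′ b′ La′ Lb′ → not-antiadjacent λ anti′ →
      TY-refute bf La′ Lb′ dist bull (edges-vacuous no-new-edge) (nonedges-met anti′)

    TX-block : BullFree T → Monogamous T → Small T L ⊎ Proper T L →
      BullFreeMonogamous (TX-pair T L)
    TX-block bf mono small-or-proper =
      if-dec BullFreeMonogamous (∣ AB T L ∣ ≤? 6)
        (λ _ → restriction-bullFree-monogamous T bf mono (AB T L))
        (λ big → proper-TX-bullFree bf (proper big small-or-proper) ,
                 TX.extend-monogamous (proj₂ (restriction-bullFree-monogamous T bf mono (AB T L)))
                                      (λ u → c-d-definite (L (proj₁ u))))
      where
      proper : ¬ Small T L → Small T L ⊎ Proper T L → Proper T L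
      proper big (inj₁ small) = ⊥-elim (big small)
      proper _   (inj₂ prop)  = prop

    TY-block : BullFree T → Monogamous T → BullFreeMonogamous (TY-pair T L)
    TY-block bf mono =
      TY-bullFree bf ,
      TY.extend-monogamous (proj₂ (restriction-bullFree-monogamous T bf mono (CDEF T L)))
                           (λ u → a-b-definite (L (proj₁ u)))

lemma3p1 : ∀ {n : ℕ} (T : TG (Fin n)) → BullFree T → Monogamous T →
    ((X : Subset n) (x : Fin n) → HomogeneousSet T X → x ∈ X →
       BullFreeMonogamous (TX-hom T X) × BullFreeMonogamous (TY-hom T X x))
    ×
    ((L : Fin n → Part) → HomogeneousPair T L → Small T L ⊎ Proper T L →
       BullFreeMonogamous (TX-pair T L) × BullFreeMonogamous (TY-pair T L))
lemma3p1 T bf mono =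
  (λ X x _ _ → restriction-bullFree-monogamous T bf mono X ,
               restriction-bullFree-monogamous T bf mono (∁ X ∪ ⁅ x ⁆)) ,
  (λ L hp small-or-proper →
     let open HomogeneousPairBlocks T L in
     TX-block hp bf mono small-or-proper , TY-block hp bf mono)
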